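{- For a positive integer $Q$ let $\mathfrak{N}_Q=\{n\in\mathbb{N}: S_{Qn}(Qn)\equiv n\pmod{Qn}\}$. Then: (i) if $Q\in\{47058,\ 2214502422,\ 8490421583559688410706771261086\}$, then $\mathfrak{N}_Q$ is non-empty; (ii) $\mathfrak{N}_{52495396602}$ is empty.
   Context: $\mathbb{N}=\{1,2,3,\dots\}$. For positive integers $m,k$, $S_m(k):=1^m+2^m+\cdots+k^m$. -}

module Defs where

open import Data.Nat using (ℕ; zero; suc; _+_; _*_; _^_; _≤_)
open import Data.Integer using (ℤ; +_; _-_)
open import Data.Integer.Divisibility using (_∣_)
open import Data.Product using (_×_)

S : ℕ → ℕ → ℕ
S m zero    = 0
S m (suc k) = S m k + suc k ^ m

InN : ℕ → ℕ → Set
InN Q n = (1 ≤ n) × ((+ (Q * n)) ∣ ((+ S (Q * n) (Q * n)) - (+ n)))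

-- Write N = Q n. If p is a prime and p ^ (j + 1) ∣ N, then r ↦ r ^ N is p-periodic modulo
-- p ^ (j + 1), because r ≡ s (mod p) implies r ^ (p ^ j) ≡ s ^ (p ^ j) (mod p ^ (j + 1)); hence
-- S_N(N) ≡ (N / p) · S_N(p) (mod p ^ (j + 1)). Modulo p, S_N(p) is -1 when (p - 1) ∣ N, by
-- Fermat, and 0 when some unit g has g ^ N ≢ 1, since multiplication by g permutes the nonzero
-- residues. For squarefree N this determines S_N(N) modulo N prime by prime, which checks the
-- three witnesses of (i) by a finite computation.
-- For (ii), Q = 52495396602 is twice an odd number and is divisible by 11 and 17 but not by 5.
-- If 8 ∤ n then 16 ∤ N, so 3 ^ N ≢ 1 (mod 17) as 3 has order 16; then S_N(N) ≡ n (mod N)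
-- turns 17 ^ j ∣ n into 17 ^ (j + 1) ∣ n, for every j. Likewise with 11 and 2 (of order 10)
-- when 5 ∤ n. If 40 ∣ n, then 4 ∣ N and n ≡ S_N(N) ≡ -N/5 (mod 5 ^ (j + 1)) turns
-- 5 ^ (j + 1) ∣ n into 5 ^ (j + 2) ∣ n. Either way every power of a prime divides n, so n = 0.

module Submission where

open import Defs
open import Data.Nat as ℕ
  using (ℕ; zero; suc; _+_; _*_; _^_; _∸_; _≤_; _<_; z≤n; s≤s; NonZero; NonTrivial; _!; _<ᵇ_)
import Data.Nat.Properties as ℕP
open import Data.Nat.DivMod
  using (_%_; _/_; m*[n/m]≡n; m≡m%n+[m/n]*n; [m+kn]%n≡m%n; m<n⇒m%n≡m; m%n<n)
open import Data.Nat.Divisibility as ℕ∣ using (divides)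
open import Data.Nat.Coprimality
  using (Coprime; coprime?; coprime-divisor; coprime-Bézout; prime⇒coprime) renaming (sym to Coprime-sym)
open import Data.Nat.Primality
  using (Prime; euclidsLemma; prime⇒nonZero; _Rough_; 2-rough; ∤⇒rough-suc; rough∧square>⇒prime)
open import Data.Nat.GCD using (module Bézout)
open import Data.Integer as ℤ using (+_)
import Data.Integer.Properties as ℤP
import Data.Integer.Divisibility.Signed as ℤ∣
open import Data.Product using (_×_; _,_; proj₁; proj₂; uncurry; ∃)
open import Data.List using (List; []; _∷_; map; applyDownFrom)
open import Data.List.Properties using (map-applyDownFrom; map-∘)
open import Data.Nat.ListAction using (sum; product)
open import Data.Nat.ListAction.Properties using (sum-↭; product-↭)
open import Data.List.Membership.Propositional using (_∈_)
open import Data.List.Membership.Propositional.Properties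
  using (∈-map⁺; ∈-map⁻; ∈-applyDownFrom⁺; ∈-applyDownFrom⁻)
open import Data.List.Relation.Unary.All using (All; []; _∷_)
open import Data.List.Relation.Unary.AllPairs using (AllPairs; []; _∷_; allPairs?)
open import Data.List.Relation.Unary.Unique.Propositional using (Unique)
import Data.List.Relation.Unary.Unique.Propositional.Properties as Unique
open import Data.List.Membership.Propositional.Properties.WithK using (unique∧set⇒bag)
open import Data.List.Relation.Binary.BagAndSetEquality using (∼bag⇒↭)
open import Data.List.Relation.Binary.Permutation.Propositional using (_↭_)
import Data.List.Relation.Binary.Permutation.Propositional.Properties as ↭
open import Function using (_∘_; id; case_of_)
open import Function.Bundles using (mk⇔)
open import Data.Sum as Sum using (_⊎_; inj₁; inj₂; [_,_]′)
open import Relation.Binary.PropositionalEquality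
open import Relation.Nullary using (¬_)
open import Relation.Nullary.Decidable using (from-yes; decidable-stable; _⊎-dec_; ¬?)
open import Data.Empty using (⊥-elim)
open import Data.Bool using (Bool; true; false; T)
open import Data.Integer.Tactic.RingSolver using () renaming (solve-∀ to ℤ-solve-∀)
open import Data.Nat.Tactic.RingSolver using () renaming (solve-∀ to ℕ-solve-∀)

infix 4 _≡_mod_

record _≡_mod_ (a b m : ℕ) : Set where
  constructor mod-intro
  field
    divides-difference : + m ℤ∣.∣ + a ℤ.- + b

open _≡_mod_ public

private
  ℤ∣-intro : ∀ {m x} q → x ≡ + (q * m) → + m ℤ∣.∣ x
  ℤ∣-intro {m} q eq = ℤ∣.divides (+ q) (trans eq (ℤP.pos-* q m))

  +-difference : ∀ {a b} → b ≤ a → + a ℤ.- + b ≡ + (a ∸ b)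
  +-difference {a} {b} b≤a = trans (ℤP.m-n≡m⊖n a b) (ℤP.⊖-≥ b≤a)

  pos-*-differenceˡ : ∀ k a b → + (k * a) ℤ.- + (k * b) ≡ + k ℤ.* (+ a ℤ.- + b)
  pos-*-differenceˡ k a b =
    trans (cong₂ ℤ._-_ (ℤP.pos-* k a) (ℤP.pos-* k b)) (factor (+ k) (+ a) (+ b))
    where
      factor : ∀ x y z → x ℤ.* y ℤ.- x ℤ.* z ≡ x ℤ.* (y ℤ.- z)
      factor = ℤ-solve-∀

  pos-*-differenceʳ : ∀ a b c → + (a * c) ℤ.- + (b * c) ≡ (+ a ℤ.- + b) ℤ.* + c
  pos-*-differenceʳ a b c =
    trans (cong₂ ℤ._-_ (ℤP.pos-* a c) (ℤP.pos-* b c)) (factor (+ a) (+ b) (+ c))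
    where
      factor : ∀ x y z → x ℤ.* z ℤ.- y ℤ.* z ≡ (x ℤ.- y) ℤ.* z
      factor = ℤ-solve-∀

≡-mod-refl : ∀ {m} a → a ≡ a mod m
≡-mod-refl a = mod-intro (ℤ∣-intro 0 (ℤP.+-inverseʳ (+ a)))

≡-mod-reflexive : ∀ {m a b} → a ≡ b → a ≡ b mod m
≡-mod-reflexive {a = a} refl = ≡-mod-refl a

≡-mod-sym : ∀ {m a b} → a ≡ b mod m → b ≡ a mod m
≡-mod-sym {m} {a} {b} (mod-intro m∣a-b) =
  mod-intro (subst (+ m ℤ∣.∣_) (neg-difference (+ a) (+ b)) (ℤ∣.∣m⇒∣-m m∣a-b))
  where
    neg-difference : ∀ x y → ℤ.- (x ℤ.- y) ≡ y ℤ.- x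
    neg-difference = ℤ-solve-∀

≡-mod-trans : ∀ {m a b c} → a ≡ b mod m → b ≡ c mod m → a ≡ c mod m
≡-mod-trans {m} {a} {b} {c} (mod-intro m∣a-b) (mod-intro m∣b-c) =
  mod-intro (subst (+ m ℤ∣.∣_) (telescope (+ a) (+ b) (+ c)) (ℤ∣.∣m∣n⇒∣m+n m∣a-b m∣b-c))
  where
    telescope : ∀ x y z → (x ℤ.- y) ℤ.+ (y ℤ.- z) ≡ x ℤ.- z
    telescope = ℤ-solve-∀

≡-mod-+ : ∀ {m a b c d} → a ≡ b mod m → c ≡ d mod m → a + c ≡ b + d mod m
≡-mod-+ {m} {a} {b} {c} {d} (mod-intro m∣a-b) (mod-intro m∣c-d) =
  mod-intro (subst (+ m ℤ∣.∣_) (sum-difference (+ a) (+ b) (+ c) (+ d))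
    (ℤ∣.∣m∣n⇒∣m+n m∣a-b m∣c-d))
  where
    sum-difference : ∀ x y z w → (x ℤ.- y) ℤ.+ (z ℤ.- w) ≡ (x ℤ.+ z) ℤ.- (y ℤ.+ w)
    sum-difference = ℤ-solve-∀

≡-mod-* : ∀ {m a b c d} → a ≡ b mod m → c ≡ d mod m → a * c ≡ b * d mod m
≡-mod-* {m} {a} {b} {c} {d} (mod-intro m∣a-b) (mod-intro m∣c-d) = mod-intro (subst (+ m ℤ∣.∣_)
  (trans (product-difference (+ a) (+ b) (+ c) (+ d)) (sym (cong₂ ℤ._-_ (ℤP.pos-* a c) (ℤP.pos-* b d))))
  (ℤ∣.∣m∣n⇒∣m+n (ℤ∣.∣m⇒∣m*n (+ c) m∣a-b) (ℤ∣.∣n⇒∣m*n (+ b) m∣c-d)))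
  where
    product-difference : ∀ x y z w → (x ℤ.- y) ℤ.* z ℤ.+ y ℤ.* (z ℤ.- w) ≡ x ℤ.* z ℤ.- y ℤ.* w
    product-difference = ℤ-solve-∀

≡-mod-^ : ∀ {m a b} e → a ≡ b mod m → a ^ e ≡ b ^ e mod m
≡-mod-^ zero    a≡b = ≡-mod-refl 1
≡-mod-^ (suc e) a≡b = ≡-mod-* a≡b (≡-mod-^ e a≡b)

≡-mod-*-scale : ∀ {m a b} k → a ≡ b mod m → k * a ≡ k * b mod k * m
≡-mod-*-scale {m} {a} {b} k (mod-intro (ℤ∣.divides q eq)) = mod-intro (ℤ∣.divides q (begin
  + (k * a) ℤ.- + (k * b) ≡⟨ pos-*-differenceˡ k a b ⟩
  + k ℤ.* (+ a ℤ.- + b)   ≡⟨ cong (+ k ℤ.*_) eq ⟩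
  + k ℤ.* (q ℤ.* + m)     ≡⟨ ℤP.*-assoc (+ k) q (+ m) ⟨
  + k ℤ.* q ℤ.* + m       ≡⟨ cong (ℤ._* + m) (ℤP.*-comm (+ k) q) ⟩
  q ℤ.* + k ℤ.* + m       ≡⟨ ℤP.*-assoc q (+ k) (+ m) ⟩
  q ℤ.* (+ k ℤ.* + m)     ≡⟨ cong (q ℤ.*_) (ℤP.pos-* k m) ⟨
  q ℤ.* + (k * m)         ∎))
  where open ≡-Reasoning

≡-mod-∣ : ∀ {d m a b} → d ℕ∣.∣ m → a ≡ b mod m → a ≡ b mod d
≡-mod-∣ (divides q refl) (mod-intro m∣a-b) = mod-intro (ℤ∣.∣-trans (ℤ∣-intro q refl) m∣a-b)

+-*≡[mod] : ∀ {m} a q → a + q * m ≡ a mod m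
+-*≡[mod] {m} a q =
  mod-intro (ℤ∣-intro q (trans (+-difference (ℕP.m≤m+n a (q * m))) (cong +_ (ℕP.m+n∸m≡n a (q * m)))))

∣⇒≡0[mod] : ∀ {m a} → m ℕ∣.∣ a → a ≡ 0 mod m
∣⇒≡0[mod] (divides q refl) = +-*≡[mod] 0 q

≡0[mod]⇒∣ : ∀ {m a} → a ≡ 0 mod m → m ℕ∣.∣ a
≡0[mod]⇒∣ {m} {a} (mod-intro m∣a-0) = subst (m ℕ∣.∣_) (ℕP.+-identityʳ a) (ℤ∣.∣⇒∣ᵤ m∣a-0)

%≡[mod] : ∀ {m} .{{_ : NonZero m}} a → a % m ≡ a mod m
%≡[mod] {m} a = subst (λ x → a % m ≡ x mod m) (sym (m≡m%n+[m/n]*n a m))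
  (≡-mod-sym (+-*≡[mod] (a % m) (a / m)))

%≡⇒≡[mod] : ∀ {m} .{{_ : NonZero m}} {a b} → a % m ≡ b % m → a ≡ b mod m
%≡⇒≡[mod] {m} {a} {b} eq =
  ≡-mod-trans (≡-mod-sym (%≡[mod] a)) (subst (λ x → x ≡ b mod m) (sym eq) (%≡[mod] b))

private
  ≡[mod]⇒%≡-≥ : ∀ {m} .{{_ : NonZero m}} {a b} → b ≤ a → a ≡ b mod m → a % m ≡ b % m
  ≡[mod]⇒%≡-≥ {m} {a} {b} b≤a (mod-intro m∣a-b)
    with divides k eq ← ℤ∣.∣⇒∣ᵤ (subst (+ m ℤ∣.∣_) (+-difference b≤a) m∣a-b) = begin
    a % m           ≡⟨ cong (_% m) (ℕP.m∸n+n≡m b≤a) ⟨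
    (a ∸ b + b) % m ≡⟨ cong (λ x → (x + b) % m) eq ⟩
    (k * m + b) % m ≡⟨ cong (_% m) (ℕP.+-comm (k * m) b) ⟩
    (b + k * m) % m ≡⟨ [m+kn]%n≡m%n b k m ⟩
    b % m           ∎
    where open ≡-Reasoning

≡[mod]⇒%≡ : ∀ {m} .{{_ : NonZero m}} {a b} → a ≡ b mod m → a % m ≡ b % m
≡[mod]⇒%≡ {a = a} {b} a≡b with ℕP.≤-total b a
... | inj₁ b≤a = ≡[mod]⇒%≡-≥ b≤a a≡b
... | inj₂ a≤b = sym (≡[mod]⇒%≡-≥ a≤b (≡-mod-sym a≡b))

≡[mod]⇒≡ : ∀ {m} .{{_ : NonZero m}} {a b} → a ≡ b mod m → a < m → b < m → a ≡ b
≡[mod]⇒≡ a≡b a<m b<m = trans (sym (m<n⇒m%n≡m a<m)) (trans (≡[mod]⇒%≡ a≡b) (m<n⇒m%n≡m b<m))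

≡-mod-+-cancelʳ : ∀ {m a b c} → a + c ≡ b + c mod m → a ≡ b mod m
≡-mod-+-cancelʳ {m} {a} {b} {c} (mod-intro m∣a+c-b+c) =
  mod-intro (subst (+ m ℤ∣.∣_) (cancel (+ a) (+ b) (+ c)) m∣a+c-b+c)
  where
    cancel : ∀ x y z → (x ℤ.+ z) ℤ.- (y ℤ.+ z) ≡ x ℤ.- y
    cancel = ℤ-solve-∀

≡-mod-*-cancelʳ-prime : ∀ {p a b c} → Prime p → a * c ≡ b * c mod p → a ≡ b mod p ⊎ c ≡ 0 mod p
≡-mod-*-cancelʳ-prime {p} {a} {b} {c} p-prime (mod-intro p∣ac-bc) =
  Sum.map (mod-intro ∘ ℤ∣.∣ᵤ⇒∣) ∣⇒≡0[mod]
    (euclidsLemma ℤ.∣ + a ℤ.- + b ∣ c p-prime p∣∣a-b∣*c)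
  where
    p∣∣a-b∣*c : p ℕ∣.∣ ℤ.∣ + a ℤ.- + b ∣ * c
    p∣∣a-b∣*c = subst (p ℕ∣.∣_) (ℤP.abs-* (+ a ℤ.- + b) (+ c))
      (ℤ∣.∣⇒∣ᵤ (subst (+ p ℤ∣.∣_) (pos-*-differenceʳ a b c) p∣ac-bc))

≡-mod-coprime-* : ∀ {m n a b} → Coprime m n → a ≡ b mod m → a ≡ b mod n → a ≡ b mod m * n
≡-mod-coprime-* {m} {n} m⊥n (mod-intro m∣a-b) (mod-intro n∣a-b)
  with divides q eq ← ℤ∣.∣⇒∣ᵤ m∣a-b =
  mod-intro (ℤ∣.∣ᵤ⇒∣ (subst (m * n ℕ∣.∣_) (sym eq) m*n∣q*m))
  where
    n∣q : n ℕ∣.∣ q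
    n∣q = coprime-divisor (Coprime-sym m⊥n)
      (subst (n ℕ∣.∣_) (trans eq (ℕP.*-comm q m)) (ℤ∣.∣⇒∣ᵤ n∣a-b))
    m*n∣q*m : m * n ℕ∣.∣ q * m
    m*n∣q*m = subst (m * n ℕ∣.∣_) (ℕP.*-comm m q) (ℕ∣.*-monoʳ-∣ m n∣q)

coprime-* : ∀ {p m n} → Coprime p m → Coprime p n → Coprime p (m * n)
coprime-* {p} {m} {n} p⊥m p⊥n (d∣p , d∣m*n) = p⊥n (d∣p , coprime-divisor d⊥m d∣m*n)
  where
    d⊥m : Coprime _ m
    d⊥m (e∣d , e∣m) = p⊥m (ℕ∣.∣-trans e∣d d∣p , e∣m)

coprime-product : ∀ {p qs} → All (Coprime p) qs → Coprime p (product qs)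
coprime-product []            (_ , d∣1) = ℕ∣.∣1⇒≡1 d∣1
coprime-product (p⊥q ∷ p⊥qs) = coprime-* p⊥q (coprime-product p⊥qs)

≡-mod-product : ∀ {a b} ps → AllPairs Coprime ps → All (a ≡ b mod_) ps → a ≡ b mod product ps
≡-mod-product {a} {b} [] _ _ = mod-intro (ℤ∣.divides (+ a ℤ.- + b) (sym (ℤP.*-identityʳ _)))
≡-mod-product (p ∷ ps) (p⊥ps ∷ coprimes) (a≡b ∷ a≡b-all) =
  ≡-mod-coprime-* (coprime-product p⊥ps) a≡b (≡-mod-product ps coprimes a≡b-all)

^-distribʳ-* : ∀ a b n → (a * b) ^ n ≡ a ^ n * b ^ n
^-distribʳ-* a b zero    = refl
^-distribʳ-* a b (suc n) = trans (cong (a * b *_) (^-distribʳ-* a b n)) (interchange a b (a ^ n) (b ^ n))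
  where
    interchange : ∀ a b c d → a * b * (c * d) ≡ a * c * (b * d)
    interchange = ℕ-solve-∀

n<m^n : ∀ {m} → 2 ≤ m → ∀ n → n < m ^ n
n<m^n         2≤m zero    = s≤s z≤n
n<m^n {m@(suc _)} 2≤m (suc n) = ℕP.≤-<-trans (n<m^n 2≤m n)
  (subst (m ^ n <_) (ℕP.*-comm (m ^ n) m) (ℕP.m<m*n (m ^ n) m {{ℕP.m^n≢0 m n}} 2≤m))

∣-all-powers⇒≡0 : ∀ {p x} → 2 ≤ p → (∀ j → p ^ j ℕ∣.∣ x → p ^ suc j ℕ∣.∣ x) → x ≡ 0
∣-all-powers⇒≡0 {p} {zero}  _   _    = refl
∣-all-powers⇒≡0 {p} {suc x} 2≤p step =
  ⊥-elim (ℕP.<⇒≱ (n<m^n 2≤p (suc x)) (ℕ∣.∣⇒≤ (all-powers (suc x))))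
  where
    all-powers : ∀ j → p ^ j ℕ∣.∣ suc x
    all-powers zero    = ℕ∣.1∣ (suc x)
    all-powers (suc j) = step j (all-powers j)

sumTo : (ℕ → ℕ) → ℕ → ℕ
sumTo f zero    = 0
sumTo f (suc k) = sumTo f k + f (suc k)

S≡sumTo : ∀ e k → S e k ≡ sumTo (_^ e) k
S≡sumTo e zero    = refl
S≡sumTo e (suc k) = cong (_+ suc k ^ e) (S≡sumTo e k)

sumTo-cong-mod : ∀ {m f g} → (∀ i → f i ≡ g i mod m) → ∀ k → sumTo f k ≡ sumTo g k mod m
sumTo-cong-mod f≡g zero    = ≡-mod-refl 0
sumTo-cong-mod f≡g (suc k) = ≡-mod-+ (sumTo-cong-mod f≡g k) (f≡g (suc k))

sumTo-+ : ∀ f p k → sumTo f (p + k) ≡ sumTo f p + sumTo (λ i → f (p + i)) k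
sumTo-+ f p zero    = trans (cong (sumTo f) (ℕP.+-identityʳ p)) (sym (ℕP.+-identityʳ (sumTo f p)))
sumTo-+ f p (suc k) = begin
  sumTo f (p + suc k)                                 ≡⟨ cong (sumTo f) (ℕP.+-suc p k) ⟩
  sumTo f (p + k) + f (suc (p + k))
    ≡⟨ cong₂ _+_ (sumTo-+ f p k) (cong f (sym (ℕP.+-suc p k))) ⟩
  sumTo f p + sumTo (λ i → f (p + i)) k + f (p + suc k) ≡⟨ ℕP.+-assoc (sumTo f p) _ _ ⟩
  sumTo f p + sumTo (λ i → f (p + i)) (suc k)         ∎
  where open ≡-Reasoning

sumTo-periodic : ∀ {m} f p → (∀ k → f (p + k) ≡ f k mod m) →
                 ∀ c → sumTo f (c * p) ≡ c * sumTo f p mod m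
sumTo-periodic f p periodic zero    = ≡-mod-refl 0
sumTo-periodic f p periodic (suc c) rewrite sumTo-+ f p (c * p) =
  ≡-mod-+ (≡-mod-refl (sumTo f p))
          (≡-mod-trans (sumTo-cong-mod periodic (c * p)) (sumTo-periodic f p periodic c))

geometricSum : ℕ → ℕ → ℕ → ℕ
geometricSum x y zero    = 0
geometricSum x y (suc n) = x ^ n + y * geometricSum x y n

^-difference : ∀ x y n → + (x ^ n) ℤ.- + (y ^ n) ≡ (+ x ℤ.- + y) ℤ.* + geometricSum x y n
^-difference x y zero    = sym (ℤP.*-zeroʳ (+ x ℤ.- + y))
^-difference x y (suc n) = begin
  + (x * x ^ n) ℤ.- + (y * y ^ n)           ≡⟨ cong₂ ℤ._-_ (ℤP.pos-* x (x ^ n)) (ℤP.pos-* y (y ^ n)) ⟩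
  X ℤ.* + (x ^ n) ℤ.- Y ℤ.* + (y ^ n)       ≡⟨ split X Y (+ (x ^ n)) (+ (y ^ n)) ⟩
  (X ℤ.- Y) ℤ.* + (x ^ n) ℤ.+ Y ℤ.* (+ (x ^ n) ℤ.- + (y ^ n))
    ≡⟨ cong (λ z → (X ℤ.- Y) ℤ.* + (x ^ n) ℤ.+ Y ℤ.* z) (^-difference x y n) ⟩
  (X ℤ.- Y) ℤ.* + (x ^ n) ℤ.+ Y ℤ.* ((X ℤ.- Y) ℤ.* G) ≡⟨ factor X Y (+ (x ^ n)) G ⟩
  (X ℤ.- Y) ℤ.* (+ (x ^ n) ℤ.+ Y ℤ.* G)
    ≡⟨ cong (λ z → (X ℤ.- Y) ℤ.* (+ (x ^ n) ℤ.+ z)) (ℤP.pos-* y _) ⟨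
  (X ℤ.- Y) ℤ.* + geometricSum x y (suc n)  ∎
  where
    open ≡-Reasoning
    X = + x
    Y = + y
    G = + geometricSum x y n
    split : ∀ a b c d → a ℤ.* c ℤ.- b ℤ.* d ≡ (a ℤ.- b) ℤ.* c ℤ.+ b ℤ.* (c ℤ.- d)
    split = ℤ-solve-∀
    factor : ∀ a b c g →
             (a ℤ.- b) ℤ.* c ℤ.+ b ℤ.* ((a ℤ.- b) ℤ.* g) ≡ (a ℤ.- b) ℤ.* (c ℤ.+ b ℤ.* g)
    factor = ℤ-solve-∀

geometricSum-≡ : ∀ {m x y} → x ≡ y mod m → ∀ n → geometricSum x y (suc n) ≡ suc n * y ^ n mod m
geometricSum-≡ {m} {x} {y} x≡y zero = ≡-mod-reflexive {m} (cong suc (ℕP.*-zeroʳ y))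
geometricSum-≡ {m} {x} {y} x≡y (suc n) =
  subst (geometricSum x y (suc (suc n)) ≡_mod m) (regroup y n (y ^ n))
    (≡-mod-+ (≡-mod-^ (suc n) x≡y) (≡-mod-* (≡-mod-refl y) (geometricSum-≡ x≡y n)))
  where
    regroup : ∀ y n z → y * z + y * (z + n * z) ≡ y * z + (y * z + n * (y * z))
    regroup = ℕ-solve-∀

geometricSum-≡0 : ∀ {p x y} → x ≡ y mod p → geometricSum x y p ≡ 0 mod p
geometricSum-≡0 {zero}  x≡y = ≡-mod-refl 0
geometricSum-≡0 {suc n} {y = y} x≡y =
  ≡-mod-trans (geometricSum-≡ x≡y n) (∣⇒≡0[mod] (ℕ∣.m∣m*n (y ^ n)))

^-lift : ∀ {p m x y} → p ℕ∣.∣ m → x ≡ y mod m → x ^ p ≡ y ^ p mod p * m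
^-lift {p} {m} {x} {y} p∣m x≡y@(mod-intro (ℤ∣.divides k x-y≡km))
  with mod-intro (ℤ∣.divides l G≡lp) ← geometricSum-≡0 {p} (≡-mod-∣ p∣m x≡y) =
  mod-intro (ℤ∣.divides (k ℤ.* l) (begin
    + (x ^ p) ℤ.- + (y ^ p)                   ≡⟨ ^-difference x y p ⟩
    (+ x ℤ.- + y) ℤ.* + geometricSum x y p
      ≡⟨ cong₂ ℤ._*_ x-y≡km (trans (sym (ℤP.+-identityʳ _)) G≡lp) ⟩
    (k ℤ.* + m) ℤ.* (l ℤ.* + p)               ≡⟨ rearrange k l (+ m) (+ p) ⟩
    (k ℤ.* l) ℤ.* (+ p ℤ.* + m)               ≡⟨ cong (k ℤ.* l ℤ.*_) (ℤP.pos-* p m) ⟨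
    (k ℤ.* l) ℤ.* + (p * m)                   ∎))
  where
    open ≡-Reasoning
    rearrange : ∀ k l m p → (k ℤ.* m) ℤ.* (l ℤ.* p) ≡ (k ℤ.* l) ℤ.* (p ℤ.* m)
    rearrange = ℤ-solve-∀

^-lift-pow : ∀ {p x y} j → x ≡ y mod p → x ^ (p ^ j) ≡ y ^ (p ^ j) mod p ^ suc j
^-lift-pow {p} {x} {y} zero x≡y =
  subst₂ (λ a b → a ≡ b mod p * 1) (sym (ℕP.*-identityʳ x)) (sym (ℕP.*-identityʳ y))
    (≡-mod-∣ (ℕ∣.∣-reflexive (ℕP.*-identityʳ p)) x≡y)
^-lift-pow {p} {x} {y} (suc j) x≡y =
  subst₂ (λ a b → a ≡ b mod p ^ suc (suc j)) (power-swap x) (power-swap y)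
    (^-lift {p} (ℕ∣.m∣m*n (p ^ j)) (^-lift-pow j x≡y))
  where
    power-swap : ∀ z → (z ^ (p ^ j)) ^ p ≡ z ^ (p ^ suc j)
    power-swap z = trans (ℕP.^-*-assoc z (p ^ j) p) (cong (z ^_) (ℕP.*-comm (p ^ j) p))

S≡quotient*S[mod] : ∀ {p m j N} → N ≡ p * m → p ^ j ℕ∣.∣ m →
                    S N N ≡ m * S N p mod p ^ suc j
S≡quotient*S[mod] {p} {m} {j} {N} N≡p*m (divides d m≡d*p^j) =
  subst₂ (_≡_mod p ^ suc j) sumTo≡S (cong (m *_) (sym (S≡sumTo N p))) (sumTo-periodic f p shift m)
  where
    f : ℕ → ℕ
    f = _^ N
    N≡p^j*[d*p] : N ≡ p ^ j * (d * p)
    N≡p^j*[d*p] = trans N≡p*m (trans (cong (p *_) m≡d*p^j) (rearrange p d (p ^ j)))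
      where
        rearrange : ∀ p d q → p * (d * q) ≡ q * (d * p)
        rearrange = ℕ-solve-∀
    split-exponent : ∀ z → (z ^ (p ^ j)) ^ (d * p) ≡ z ^ N
    split-exponent z = trans (ℕP.^-*-assoc z (p ^ j) (d * p)) (cong (z ^_) (sym N≡p^j*[d*p]))
    shift : ∀ k → f (p + k) ≡ f k mod p ^ suc j
    shift k = subst₂ (_≡_mod p ^ suc j) (split-exponent (p + k)) (split-exponent k)
      (≡-mod-^ (d * p) (^-lift-pow j p+k≡k))
      where
        p+k≡k : p + k ≡ k mod p
        p+k≡k = subst (_≡ k mod p) (trans (cong (λ z → k + z) (ℕP.*-identityˡ p)) (ℕP.+-comm k p))
          (+-*≡[mod] k 1)
    sumTo≡S : sumTo f (m * p) ≡ S N N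
    sumTo≡S = trans (cong (sumTo f) (trans (ℕP.*-comm m p) (sym N≡p*m))) (sym (S≡sumTo N N))

≡-mod-*-scale-pow : ∀ {p j m s t} → s ≡ t mod p → p ^ j ℕ∣.∣ m → m * s ≡ m * t mod p ^ suc j
≡-mod-*-scale-pow {p} {j} {m} s≡t p^j∣m =
  ≡-mod-∣ (subst (ℕ∣._∣ m * p) (ℕP.*-comm (p ^ j) p) (ℕ∣.*-monoˡ-∣ p p^j∣m))
    (≡-mod-*-scale m s≡t)

positives : ℕ → List ℕ
positives = applyDownFrom suc

∈-positives⁻ : ∀ {k x} → x ∈ positives k → 1 ≤ x × x ≤ k
∈-positives⁻ x∈ with i , i<k , refl ← ∈-applyDownFrom⁻ suc x∈ = s≤s z≤n , i<k

∈-positives⁺ : ∀ {k x} → 1 ≤ x → x ≤ k → x ∈ positives k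
∈-positives⁺ {x = suc i} _ x≤k = ∈-applyDownFrom⁺ suc x≤k

positives-unique : ∀ k → Unique (positives k)
positives-unique k = Unique.applyDownFrom⁺₁ suc k (λ j<i _ eq → ℕP.<⇒≢ j<i (sym (ℕP.suc-injective eq)))

product-positives : ∀ k → product (positives k) ≡ k !
product-positives zero    = refl
product-positives (suc k) = cong (suc k *_) (product-positives k)

S≡sum-positives : ∀ e k → S e k ≡ sum (map (_^ e) (positives k))
S≡sum-positives e zero    = refl
S≡sum-positives e (suc k) =
  trans (ℕP.+-comm (S e k) (suc k ^ e)) (cong (_+_ (suc k ^ e)) (S≡sum-positives e k))

module UnitMultiplication {k : ℕ} (g h : ℕ) (gh≡1 : g * h ≡ 1 mod suc k) where

  private
    m : ℕ
    m = suc k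

    hg≡1 : h * g ≡ 1 mod m
    hg≡1 = subst (_≡ 1 mod m) (ℕP.*-comm g h) gh≡1

    undo-multiplication : ∀ a b {r} → a * b ≡ 1 mod m → r ≤ k → b * (a * r % m) % m ≡ r
    undo-multiplication a b {r} ab≡1 r≤k = ≡[mod]⇒≡ b[ar]≡r (m%n<n (b * (a * r % m)) m) (s≤s r≤k)
      where
        b[ar]≡r : b * (a * r % m) % m ≡ r mod m
        b[ar]≡r = ≡-mod-trans (%≡[mod] (b * (a * r % m)))
          (≡-mod-trans (≡-mod-* (≡-mod-refl b) (%≡[mod] (a * r)))
          (subst (_≡ r mod m) (ℕP.*-assoc b a r)
            (subst (b * a * r ≡_mod m) (ℕP.*-identityˡ r)
              (≡-mod-* (subst (_≡ 1 mod m) (ℕP.*-comm a b) ab≡1) (≡-mod-refl r)))))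

    stays-positive : ∀ a b {r} → a * b ≡ 1 mod m → 1 ≤ r → r ≤ k → 1 ≤ a * r % m × a * r % m ≤ k
    stays-positive a b {r} ab≡1 1≤r r≤k =
      ℕP.n≢0⇒n>0 nonzero , ℕP.≤-pred (m%n<n (a * r) m)
      where
        nonzero : a * r % m ≢ 0
        nonzero ar≡0 = ℕP.<⇒≢ 1≤r (sym (trans (sym (undo-multiplication a b ab≡1 r≤k))
          (trans (cong (λ x → b * x % m) ar≡0) (cong (_% m) (ℕP.*-zeroʳ b)))))

  multiplyBy : ℕ → ℕ
  multiplyBy r = g * r % m

  multiplyBy-↭ : map multiplyBy (positives k) ↭ positives k
  multiplyBy-↭ = ∼bag⇒↭ (unique∧set⇒bag unique-image (positives-unique k) (mk⇔ into onto))
    where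
      injective : ∀ {i j} → j < i → i < k → multiplyBy (suc i) ≢ multiplyBy (suc j)
      injective {i} {j} j<i i<k eq = ℕP.<⇒≢ j<i (sym (ℕP.suc-injective (begin
        suc i                                ≡⟨ undo-multiplication g h gh≡1 i<k ⟨
        h * multiplyBy (suc i) % m           ≡⟨ cong (λ x → h * x % m) eq ⟩
        h * multiplyBy (suc j) % m           ≡⟨ undo-multiplication g h gh≡1 (ℕP.<-trans j<i i<k) ⟩
        suc j                                ∎)))
        where open ≡-Reasoning
      unique-image : Unique (map multiplyBy (positives k))
      unique-image = subst Unique (sym (map-applyDownFrom suc multiplyBy k))
        (Unique.applyDownFrom⁺₁ (multiplyBy ∘ suc) k injective)
      into : ∀ {x} → x ∈ map multiplyBy (positives k) → x ∈ positives k
      into x∈ with r , r∈ , refl ← ∈-map⁻ multiplyBy x∈ =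
        let 1≤r , r≤k = ∈-positives⁻ r∈ in uncurry ∈-positives⁺ (stays-positive g h gh≡1 1≤r r≤k)
      onto : ∀ {x} → x ∈ positives k → x ∈ map multiplyBy (positives k)
      onto {x} x∈ = subst (_∈ map multiplyBy (positives k)) (undo-multiplication h g hg≡1 x≤k)
        (∈-map⁺ multiplyBy (uncurry ∈-positives⁺ (stays-positive h g hg≡1 1≤x x≤k)))
        where
          1≤x = proj₁ (∈-positives⁻ x∈)
          x≤k = proj₂ (∈-positives⁻ x∈)

  sum-multiplyBy : ∀ F → sum (map (F ∘ multiplyBy) (positives k)) ≡ sum (map F (positives k))
  sum-multiplyBy F = trans (cong sum (map-∘ (positives k))) (sum-↭ (↭.map⁺ F multiplyBy-↭))

  product-multiplyBy : product (map multiplyBy (positives k)) ≡ k !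
  product-multiplyBy = trans (product-↭ multiplyBy-↭) (product-positives k)

∃-inverse-mod-prime : ∀ {p g} → Prime p → 1 ≤ g → g < p → ∃ λ h → g * h ≡ 1 mod p
∃-inverse-mod-prime {suc k} {g@(suc _)} p-prime _ g<p with coprime-Bézout (prime⇒coprime p-prime g<p)
... | Bézout.-+ x y 1+x*p≡y*g =
  y , subst (_≡ 1 mod suc k) (trans 1+x*p≡y*g (ℕP.*-comm y g)) (+-*≡[mod] 1 x)
... | Bézout.+- x y 1+y*g≡x*p = y * k , subst (_≡ 1 mod suc k) (ℕP.*-assoc g y k) gy*k≡1
  where
    -- g * y ≡ -1, so y * (p - 1) is an inverse of g
    gy*k+gy≡0 : g * y * k + g * y ≡ 0 mod suc k
    gy*k+gy≡0 = subst (_≡ 0 mod suc k) (regroup (g * y) k) (∣⇒≡0[mod] (ℕ∣.n∣m*n (g * y)))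
      where
        regroup : ∀ a k → a * suc k ≡ a * k + a
        regroup = ℕ-solve-∀
    1+gy≡0 : 1 + g * y ≡ 0 mod suc k
    1+gy≡0 = subst (_≡ 0 mod suc k) (sym (trans (cong suc (ℕP.*-comm g y)) 1+y*g≡x*p)) (+-*≡[mod] 0 x)
    gy*k≡1 : g * y * k ≡ 1 mod suc k
    gy*k≡1 = ≡-mod-+-cancelʳ (≡-mod-trans gy*k+gy≡0 (≡-mod-sym 1+gy≡0))

prime∤! : ∀ {p} → Prime p → ∀ {k} → k < p → ¬ p ℕ∣.∣ k !
prime∤! p-prime {zero} _ p∣1 with refl ← ℕ∣.∣1⇒≡1 p∣1 with () ← p-prime
prime∤! p-prime {suc k} k<p p∣k! with euclidsLemma (suc k) (k !) p-prime p∣k!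
... | inj₁ p∣suc-k = ℕP.<⇒≱ k<p (ℕ∣.∣⇒≤ p∣suc-k)
... | inj₂ p∣k!    = prime∤! p-prime (ℕP.<-trans (ℕP.n<1+n k) k<p) p∣k!

fermat : ∀ {p g} → Prime p → 1 ≤ g → g < p → g ^ (p ∸ 1) ≡ 1 mod p
fermat {suc k} {g} p-prime 1≤g g<p with h , gh≡1 ← ∃-inverse-mod-prime p-prime 1≤g g<p =
  cancel (≡-mod-*-cancelʳ-prime p-prime 1*k!≡g^k*k!)
  where
    open UnitMultiplication g h gh≡1
    image-product : ∀ j → product (map multiplyBy (positives j)) ≡ g ^ j * j ! mod suc k
    image-product zero    = ≡-mod-refl 1
    image-product (suc j) = subst (product (map multiplyBy (positives (suc j))) ≡_mod suc k)
      (rearrange g (suc j) (g ^ j) (j !))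
      (≡-mod-* (%≡[mod] (g * suc j)) (image-product j))
      where
        rearrange : ∀ g s G P → g * s * (G * P) ≡ g * G * (s * P)
        rearrange = ℕ-solve-∀
    1*k!≡g^k*k! : 1 * k ! ≡ g ^ k * k ! mod suc k
    1*k!≡g^k*k! = subst (_≡ g ^ k * k ! mod suc k) (trans product-multiplyBy (sym (ℕP.*-identityˡ (k !))))
      (image-product k)
    cancel : 1 ≡ g ^ k mod suc k ⊎ k ! ≡ 0 mod suc k → g ^ k ≡ 1 mod suc k
    cancel (inj₁ 1≡g^k) = ≡-mod-sym 1≡g^k
    cancel (inj₂ k!≡0)  = ⊥-elim (prime∤! p-prime (ℕP.n<1+n k) (≡0[mod]⇒∣ k!≡0))

S+1≡0[mod-prime] : ∀ {p N} → Prime p → .{{NonZero N}} → (p ∸ 1) ℕ∣.∣ N → S N p + 1 ≡ 0 mod p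
S+1≡0[mod-prime] {suc k} {N@(suc N′)} p-prime (divides q N≡q*k) = ≡-mod-trans
  (≡-mod-+ (≡-mod-+ (units-sum k ℕP.≤-refl) (∣⇒≡0[mod] (ℕ∣.m∣m*n (suc k ^ N′)))) (≡-mod-refl 1))
  (subst (_≡ 0 mod suc k) (sym (k+0+1≡1+k k)) (∣⇒≡0[mod] ℕ∣.∣-refl))
  where
    k+0+1≡1+k : ∀ k → k + 0 + 1 ≡ suc k
    k+0+1≡1+k = ℕ-solve-∀
    unit-power : ∀ {r} → 1 ≤ r → r ≤ k → r ^ N ≡ 1 mod suc k
    unit-power {r} 1≤r r≤k = subst₂ (_≡_mod suc k)
      (trans (ℕP.^-*-assoc r k q) (cong (r ^_) (trans (ℕP.*-comm k q) (sym N≡q*k))))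
      (ℕP.^-zeroˡ q)
      (≡-mod-^ q (fermat p-prime 1≤r (s≤s r≤k)))
    units-sum : ∀ j → j ≤ k → S N j ≡ j mod suc k
    units-sum zero    _   = ≡-mod-refl 0
    units-sum (suc j) j<k = subst (S N (suc j) ≡_mod suc k) (ℕP.+-comm j 1)
      (≡-mod-+ (units-sum j (ℕP.<⇒≤ j<k)) (unit-power (s≤s z≤n) j<k))

S≡0[mod-prime] : ∀ {p g N} → Prime p → 1 ≤ g → g < p → ¬ g ^ N ≡ 1 mod p → S N p ≡ 0 mod p
S≡0[mod-prime] {N = zero} _ _ _ g^0≢1 = ⊥-elim (g^0≢1 (≡-mod-refl 1))
S≡0[mod-prime] {suc k} {g} {N@(suc N′)} p-prime 1≤g g<p g^N≢1
  with h , gh≡1 ← ∃-inverse-mod-prime p-prime 1≤g g<p =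
  subst (_≡ 0 mod suc k) (sym (cong (_+ suc k ^ N) (S≡sum-positives N k)))
    (≡-mod-+ U≡0 (∣⇒≡0[mod] (ℕ∣.m∣m*n (suc k ^ N′))))
  where
    open UnitMultiplication g h gh≡1
    F : ℕ → ℕ
    F = _^ N
    U : ℕ
    U = sum (map F (positives k))
    image-sum : ∀ j → sum (map (F ∘ multiplyBy) (positives j)) ≡ g ^ N * sum (map F (positives j)) mod suc k
    image-sum zero    = ≡-mod-reflexive (sym (ℕP.*-zeroʳ (g ^ N)))
    image-sum (suc j) =
      subst (sum (map (F ∘ multiplyBy) (positives (suc j))) ≡_mod suc k)
        (sym (ℕP.*-distribˡ-+ (g ^ N) (suc j ^ N) (sum (map F (positives j)))))
        (≡-mod-+ (subst (F (multiplyBy (suc j)) ≡_mod suc k) (^-distribʳ-* g (suc j) N)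
                   (≡-mod-^ N (%≡[mod] (g * suc j))))
                 (image-sum j))
    1*U≡g^N*U : 1 * U ≡ g ^ N * U mod suc k
    1*U≡g^N*U = subst (_≡ g ^ N * U mod suc k) (trans (sum-multiplyBy F) (sym (ℕP.*-identityˡ U)))
      (image-sum k)
    U≡0 : U ≡ 0 mod suc k
    U≡0 = [ (λ 1≡g^N → ⊥-elim (g^N≢1 (≡-mod-sym 1≡g^N))) , id ]′
      (≡-mod-*-cancelʳ-prime p-prime 1*U≡g^N*U)

S+quotient≡0[mod] : ∀ {p m j N} → Prime p → .{{NonZero N}} → (p ∸ 1) ℕ∣.∣ N →
                    N ≡ p * m → p ^ j ℕ∣.∣ m → S N N + m ≡ 0 mod p ^ suc j
S+quotient≡0[mod] {p} {m} {j} {N} p-prime p-1∣N N≡p*m p^j∣m =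
  ≡-mod-trans (≡-mod-+ (S≡quotient*S[mod] {p} {m} {j} N≡p*m p^j∣m) (≡-mod-refl m))
    (subst₂ (_≡_mod p ^ suc j) (expand m (S N p)) (ℕP.*-zeroʳ m)
      (≡-mod-*-scale-pow {p} {j} (S+1≡0[mod-prime] p-prime p-1∣N) p^j∣m))
  where
    expand : ∀ m s → m * (s + 1) ≡ m * s + m
    expand = ℕ-solve-∀

S≡0[mod] : ∀ {p m j N} → S N p ≡ 0 mod p → N ≡ p * m → p ^ j ℕ∣.∣ m → S N N ≡ 0 mod p ^ suc j
S≡0[mod] {p} {m} {j} {N} S[p]≡0 N≡p*m p^j∣m =
  ≡-mod-trans (S≡quotient*S[mod] {p} {m} {j} N≡p*m p^j∣m)
    (subst (m * S N p ≡_mod p ^ suc j) (ℕP.*-zeroʳ m) (≡-mod-*-scale-pow {p} {j} S[p]≡0 p^j∣m))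

S≡n⇒p^[1+j]∣n-of-vanishing : ∀ {p Q n j} → p ℕ∣.∣ Q → S (Q * n) p ≡ 0 mod p →
  S (Q * n) (Q * n) ≡ n mod Q * n → p ^ j ℕ∣.∣ n → p ^ suc j ℕ∣.∣ n
S≡n⇒p^[1+j]∣n-of-vanishing {p} {Q} {n} {j} (divides q refl) S[p]≡0 S≡n p^j∣n =
  ≡0[mod]⇒∣ (≡-mod-trans (≡-mod-sym (≡-mod-∣ p^[1+j]∣N S≡n))
    (S≡0[mod] {p} {q * n} {j} S[p]≡0 N≡p*[q*n] (ℕ∣.∣n⇒∣m*n q p^j∣n)))
  where
    N≡p*[q*n] : q * p * n ≡ p * (q * n)
    N≡p*[q*n] = regroup q p n
      where
        regroup : ∀ q p n → q * p * n ≡ p * (q * n)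
        regroup = ℕ-solve-∀
    p^[1+j]∣N : p ^ suc j ℕ∣.∣ q * p * n
    p^[1+j]∣N = subst (p ^ suc j ℕ∣.∣_) (sym N≡p*[q*n]) (ℕ∣.*-monoʳ-∣ p (ℕ∣.∣n⇒∣m*n q p^j∣n))

S≡n⇒p^[2+j]∣n-of-fermat : ∀ {p Q n j} → Prime p → ¬ p ℕ∣.∣ Q → .{{NonZero (Q * n)}} →
  (p ∸ 1) ℕ∣.∣ Q * n →
  S (Q * n) (Q * n) ≡ n mod Q * n → p ^ suc j ℕ∣.∣ n → p ^ suc (suc j) ℕ∣.∣ n
S≡n⇒p^[2+j]∣n-of-fermat {p} {Q} {j = j} p-prime p∤Q p-1∣N S≡n (divides t refl) =
  [ (λ p∣p+Q → ⊥-elim (p∤Q (ℕ∣.∣m+n∣m⇒∣n p∣p+Q ℕ∣.∣-refl))) , ℕ∣.*-monoˡ-∣ (p ^ suc j) ]′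
    (euclidsLemma (p + Q) t p-prime p∣[p+Q]*t)
  where
    m : ℕ
    m = p ^ j * (Q * t)
    n+m≡0 : t * (p * p ^ j) + m ≡ 0 mod p ^ suc j
    n+m≡0 = ≡-mod-trans
      (≡-mod-+ (≡-mod-sym (≡-mod-∣ (ℕ∣.∣n⇒∣m*n Q (ℕ∣.n∣m*n t)) S≡n)) (≡-mod-refl m))
      (S+quotient≡0[mod] {j = j} p-prime p-1∣N (regroup Q t p (p ^ j)) (ℕ∣.m∣m*n (Q * t)))
      where
        regroup : ∀ Q t p P → Q * (t * (p * P)) ≡ p * (P * (Q * t))
        regroup = ℕ-solve-∀
    p∣[p+Q]*t : p ℕ∣.∣ (p + Q) * t
    p∣[p+Q]*t = ℕ∣.*-cancelˡ-∣ (p ^ j) {{ℕP.m^n≢0 p j {{prime⇒nonZero p-prime}}}}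
      (subst₂ ℕ∣._∣_ (ℕP.*-comm p (p ^ j)) (factor t p (p ^ j) Q) (≡0[mod]⇒∣ n+m≡0))
      where
        factor : ∀ t p P Q → t * (p * P) + P * (Q * t) ≡ P * ((p + Q) * t)
        factor = ℕ-solve-∀

≢1-of-order : ∀ {p g e N} .{{_ : NonZero p}} .{{_ : NonZero e}} → g ^ e ≡ 1 mod p →
  (∀ {r} → r < e → r ≡ 0 ⊎ g ^ r % p ≢ 1 % p) → ¬ e ℕ∣.∣ N → ¬ g ^ N ≡ 1 mod p
≢1-of-order {p} {g} {e} {N} g^e≡1 below-order e∤N g^N≡1 =
  [ e∤N ∘ ℕ∣.m%n≡0⇒n∣m N e , (λ g^[N%e]≢1 → g^[N%e]≢1 (≡[mod]⇒%≡ g^[N%e]≡1)) ]′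
    (below-order (m%n<n N e))
  where
    split : g ^ N ≡ g ^ (N % e) * (g ^ e) ^ (N / e)
    split = begin
      g ^ N                               ≡⟨ cong (g ^_) (m≡m%n+[m/n]*n N e) ⟩
      g ^ (N % e + N / e * e)             ≡⟨ ℕP.^-distribˡ-+-* g (N % e) (N / e * e) ⟩
      g ^ (N % e) * g ^ (N / e * e)       ≡⟨ cong (λ x → g ^ (N % e) * g ^ x) (ℕP.*-comm (N / e) e) ⟩
      g ^ (N % e) * g ^ (e * (N / e))     ≡⟨ cong (g ^ (N % e) *_) (ℕP.^-*-assoc g e (N / e)) ⟨
      g ^ (N % e) * (g ^ e) ^ (N / e)     ∎
      where open ≡-Reasoning
    g^N≡g^[N%e] : g ^ N ≡ g ^ (N % e) mod p
    g^N≡g^[N%e] = subst₂ (_≡_mod p) (sym split)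
      (trans (cong (g ^ (N % e) *_) (ℕP.^-zeroˡ (N / e))) (ℕP.*-identityʳ _))
      (≡-mod-* (≡-mod-refl (g ^ (N % e))) (≡-mod-^ (N / e) g^e≡1))
    g^[N%e]≡1 : g ^ (N % e) ≡ 1 mod p
    g^[N%e]≡1 = ≡-mod-trans (≡-mod-sym g^N≡g^[N%e]) g^N≡1

-- Any fuel gives a correct result (powMod-≡); fuel above log₂ e makes it fast.
powMod : ℕ → (m : ℕ) → .{{NonZero m}} → ℕ → ℕ → ℕ
powMod zero       m b e = b ^ e
powMod (suc fuel) m b e = square-and-multiply (powMod fuel m b (e / 2))
  where
    square-and-multiply : ℕ → ℕ
    square-and-multiply r = b ^ (e % 2) * (r * r) % m

powMod-≡ : ∀ fuel m .{{_ : NonZero m}} b e → powMod fuel m b e ≡ b ^ e mod m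
powMod-≡ zero       m b e = ≡-mod-refl (b ^ e)
powMod-≡ (suc fuel) m b e = ≡-mod-trans (%≡[mod] _)
  (subst (b ^ (e % 2) * (powMod fuel m b (e / 2) * powMod fuel m b (e / 2)) ≡_mod m) exponent-split
    (≡-mod-* (≡-mod-refl (b ^ (e % 2))) (≡-mod-* half half)))
  where
    half = powMod-≡ fuel m b (e / 2)
    exponent-split : b ^ (e % 2) * (b ^ (e / 2) * b ^ (e / 2)) ≡ b ^ e
    exponent-split = begin
      b ^ (e % 2) * (b ^ (e / 2) * b ^ (e / 2))
        ≡⟨ cong (b ^ (e % 2) *_) (ℕP.^-distribˡ-+-* b (e / 2) (e / 2)) ⟨
      b ^ (e % 2) * b ^ (e / 2 + e / 2)         ≡⟨ ℕP.^-distribˡ-+-* b (e % 2) (e / 2 + e / 2) ⟨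
      b ^ (e % 2 + (e / 2 + e / 2))             ≡⟨ cong (λ x → b ^ (e % 2 + x)) (twice (e / 2)) ⟩
      b ^ (e % 2 + e / 2 * 2)                   ≡⟨ cong (b ^_) (m≡m%n+[m/n]*n e 2) ⟨
      b ^ e                                     ∎
      where
        open ≡-Reasoning
        twice : ∀ x → x + x ≡ x * 2
        twice = ℕ-solve-∀

¬^≡1-by-powMod : ∀ fuel {m} .{{_ : NonZero m}} b e → powMod fuel m b e % m ≢ 1 % m → ¬ b ^ e ≡ 1 mod m
¬^≡1-by-powMod fuel {m} b e powMod≢1 b^e≡1 =
  powMod≢1 (≡[mod]⇒%≡ (≡-mod-trans (powMod-≡ fuel m b e) b^e≡1))

-- noDivisorAmong n d k tests the candidate divisors d + 1, …, d + k of n.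
noDivisorAmong : ℕ → ℕ → ℕ → Bool
noDivisorAmong n d zero    = true
noDivisorAmong n d (suc k) with n % suc d
... | zero  = false
... | suc _ = noDivisorAmong n (suc d) k

noDivisorAmong-rough : ∀ n d k → noDivisorAmong n d k ≡ true → suc d Rough n → (suc d + k) Rough n
noDivisorAmong-rough n d zero    _  rough = subst (_Rough n) (sym (ℕP.+-identityʳ (suc d))) rough
noDivisorAmong-rough n d (suc k) ok rough with n % suc d in n%d≡r
... | suc _ = subst (_Rough n) (sym (ℕP.+-suc (suc d) k))
  (noDivisorAmong-rough n (suc d) k ok (∤⇒rough-suc d∤n rough))
  where
    d∤n : ¬ suc d ℕ∣.∣ n
    d∤n d∣n = ℕP.1+n≢0 (trans (sym n%d≡r) (ℕ∣.n∣m⇒m%n≡0 n (suc d) d∣n))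

prime-by-trial-division : ∀ n k .{{_ : NonTrivial n}} → T (n <ᵇ (2 + k) * (2 + k)) →
                          noDivisorAmong n 1 k ≡ true → Prime n
prime-by-trial-division n k n<[2+k]² ok =
  rough∧square>⇒prime (noDivisorAmong-rough n 1 k ok 2-rough) (ℕP.<ᵇ⇒< n _ n<[2+k]²)

-- Q and n are parameters and the side conditions are closed computations, so that concrete
-- instances check by refl; unifying against S (Q * n) (Q * n) would make Agda evaluate it.
module LocalToGlobal (Q n : ℕ) where

  S≡n-mod-prime-of-fermat : ∀ {p} → Prime p → .{{_ : NonZero p}} → .{{_ : NonZero (p ∸ 1)}} →
    .{{_ : NonZero (Q * n)}} → Q * n % p ≡ 0 → Q * n % (p ∸ 1) ≡ 0 → (n + Q * n / p) % p ≡ 0 →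
    S (Q * n) (Q * n) ≡ n mod p
  S≡n-mod-prime-of-fermat {p} p-prime N%p≡0 N%[p-1]≡0 [n+N/p]%p≡0 =
    ≡-mod-+-cancelʳ (≡-mod-trans S+N/p≡0 (≡-mod-sym n+N/p≡0))
    where
      S+N/p≡0 : S (Q * n) (Q * n) + Q * n / p ≡ 0 mod p
      S+N/p≡0 = ≡-mod-∣ (ℕ∣.∣-reflexive (sym (ℕP.*-identityʳ p)))
        (S+quotient≡0[mod] {j = 0} p-prime (ℕ∣.m%n≡0⇒n∣m _ (p ∸ 1) N%[p-1]≡0)
          (sym (m*[n/m]≡n (ℕ∣.m%n≡0⇒n∣m _ p N%p≡0))) (ℕ∣.1∣ _))
      n+N/p≡0 : n + Q * n / p ≡ 0 mod p
      n+N/p≡0 = ∣⇒≡0[mod] (ℕ∣.m%n≡0⇒n∣m _ p [n+N/p]%p≡0)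

  S≡n-mod-prime-of-nonresidue : ∀ {p} g → Prime p → .{{_ : NonZero p}} → 1 ≤ g → g < p →
    ¬ g ^ (Q * n) ≡ 1 mod p → Q * n % p ≡ 0 → n % p ≡ 0 → S (Q * n) (Q * n) ≡ n mod p
  S≡n-mod-prime-of-nonresidue {p} g p-prime 1≤g g<p g^N≢1 N%p≡0 n%p≡0 =
    ≡-mod-trans S≡0 (≡-mod-sym (∣⇒≡0[mod] (ℕ∣.m%n≡0⇒n∣m n p n%p≡0)))
    where
      S≡0 : S (Q * n) (Q * n) ≡ 0 mod p
      S≡0 = ≡-mod-∣ (ℕ∣.∣-reflexive (sym (ℕP.*-identityʳ p)))
        (S≡0[mod] {j = 0} (S≡0[mod-prime] {N = Q * n} p-prime 1≤g g<p g^N≢1)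
          (sym (m*[n/m]≡n (ℕ∣.m%n≡0⇒n∣m _ p N%p≡0))) (ℕ∣.1∣ _))

  InN-of-local : ∀ ps → 1 ≤ n → product ps ≡ Q * n → AllPairs Coprime ps →
                 All (S (Q * n) (Q * n) ≡ n mod_) ps → InN Q n
  InN-of-local ps 1≤n ∏ps≡N coprimes local =
    1≤n , ℤ∣.∣⇒∣ᵤ (divides-difference
      (subst (S (Q * n) (Q * n) ≡ n mod_) ∏ps≡N (≡-mod-product ps coprimes local)))

prime-2 : Prime 2
prime-2 = prime-by-trial-division 2 0 _ refl

prime-3 : Prime 3
prime-3 = prime-by-trial-division 3 0 _ refl

prime-5 : Prime 5
prime-5 = prime-by-trial-division 5 1 _ refl

prime-11 : Prime 11
prime-11 = prime-by-trial-division 11 2 _ refl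

prime-17 : Prime 17
prime-17 = prime-by-trial-division 17 3 _ refl

prime-23 : Prime 23
prime-23 = prime-by-trial-division 23 3 _ refl

prime-31 : Prime 31
prime-31 = prime-by-trial-division 31 4 _ refl

prime-47059 : Prime 47059
prime-47059 = prime-by-trial-division 47059 215 _ refl

prime-100788283 : Prime 100788283
prime-100788283 = prime-by-trial-division 100788283 10038 _ refl

prime-2217342227 : Prime 2217342227
prime-2217342227 = prime-by-trial-division 2217342227 47087 _ refl

prime-78595501069 : Prime 78595501069
prime-78595501069 = prime-by-trial-division 78595501069 280347 _ refl

prime-1729101023519 : Prime 1729101023519
prime-1729101023519 = prime-by-trial-division 1729101023519 1314951 _ refl

witness-47058 : InN 47058 5
witness-47058 = InN-of-local primes (s≤s z≤n) refl (from-yes (allPairs? coprime? primes))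
  ( S≡n-mod-prime-of-fermat prime-2 refl refl refl
  ∷ S≡n-mod-prime-of-fermat prime-3 refl refl refl
  ∷ S≡n-mod-prime-of-nonresidue 2 prime-5 (s≤s z≤n) (s≤s (s≤s (s≤s z≤n)))
      (¬^≡1-by-powMod 200 2 (47058 * 5) λ ()) refl refl
  ∷ S≡n-mod-prime-of-fermat prime-11 refl refl refl
  ∷ S≡n-mod-prime-of-fermat prime-23 refl refl refl
  ∷ S≡n-mod-prime-of-fermat prime-31 refl refl refl
  ∷ [])
  where
    open LocalToGlobal 47058 5
    primes : List ℕ
    primes = 2 ∷ 3 ∷ 5 ∷ 11 ∷ 23 ∷ 31 ∷ []

witness-2214502422 : InN 2214502422 5
witness-2214502422 = InN-of-local primes (s≤s z≤n) refl (from-yes (allPairs? coprime? primes))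
  ( S≡n-mod-prime-of-fermat prime-2 refl refl refl
  ∷ S≡n-mod-prime-of-fermat prime-3 refl refl refl
  ∷ S≡n-mod-prime-of-nonresidue 2 prime-5 (s≤s z≤n) (s≤s (s≤s (s≤s z≤n)))
      (¬^≡1-by-powMod 200 2 (2214502422 * 5) λ ()) refl refl
  ∷ S≡n-mod-prime-of-fermat prime-11 refl refl refl
  ∷ S≡n-mod-prime-of-fermat prime-23 refl refl refl
  ∷ S≡n-mod-prime-of-fermat prime-31 refl refl refl
  ∷ S≡n-mod-prime-of-fermat prime-47059 refl refl refl
  ∷ [])
  where
    open LocalToGlobal 2214502422 5
    primes : List ℕ
    primes = 2 ∷ 3 ∷ 5 ∷ 11 ∷ 23 ∷ 31 ∷ 47059 ∷ []

witness-8490421583559688410706771261086 :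
  InN 8490421583559688410706771261086 39607528021345872635
witness-8490421583559688410706771261086 =
  InN-of-local primes (s≤s z≤n) refl (from-yes (allPairs? coprime? primes))
  ( S≡n-mod-prime-of-fermat prime-2 refl refl refl
  ∷ S≡n-mod-prime-of-fermat prime-3 refl refl refl
  ∷ S≡n-mod-prime-of-nonresidue 2 prime-5 (s≤s z≤n) (s≤s (s≤s (s≤s z≤n)))
      (¬^≡1-by-powMod 200 2 (8490421583559688410706771261086 * 39607528021345872635) λ ()) refl refl
  ∷ S≡n-mod-prime-of-fermat prime-11 refl refl refl
  ∷ S≡n-mod-prime-of-fermat prime-23 refl refl refl
  ∷ S≡n-mod-prime-of-fermat prime-31 refl refl refl
  ∷ S≡n-mod-prime-of-fermat prime-47059 refl refl refl
  ∷ S≡n-mod-prime-of-nonresidue 2 prime-100788283 (s≤s z≤n) (s≤s (s≤s (s≤s z≤n)))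
      (¬^≡1-by-powMod 200 2 (8490421583559688410706771261086 * 39607528021345872635) λ ()) refl refl
  ∷ S≡n-mod-prime-of-fermat prime-2217342227 refl refl refl
  ∷ S≡n-mod-prime-of-nonresidue 2 prime-78595501069 (s≤s z≤n) (s≤s (s≤s (s≤s z≤n)))
      (¬^≡1-by-powMod 200 2 (8490421583559688410706771261086 * 39607528021345872635) λ ()) refl refl
  ∷ S≡n-mod-prime-of-fermat prime-1729101023519 refl refl refl
  ∷ [])
  where
    open LocalToGlobal 8490421583559688410706771261086 39607528021345872635
    primes : List ℕ
    primes = 2 ∷ 3 ∷ 5 ∷ 11 ∷ 23 ∷ 31 ∷ 47059 ∷ 100788283 ∷ 2217342227 ∷ 78595501069
           ∷ 1729101023519 ∷ []

3^r≢1-mod-17-below-16 : ∀ {r} → r < 16 → r ≡ 0 ⊎ 3 ^ r % 17 ≢ 1 % 17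
3^r≢1-mod-17-below-16 = from-yes (ℕP.allUpTo? (λ r → r ℕ.≟ 0 ⊎-dec ¬? (3 ^ r % 17 ℕ.≟ 1 % 17)) 16)

2^r≢1-mod-11-below-10 : ∀ {r} → r < 10 → r ≡ 0 ⊎ 2 ^ r % 11 ≢ 1 % 11
2^r≢1-mod-11-below-10 = from-yes (ℕP.allUpTo? (λ r → r ℕ.≟ 0 ⊎-dec ¬? (2 ^ r % 11 ℕ.≟ 1 % 11)) 10)

no-solution-52495396602 : ∀ n → ¬ InN 52495396602 n
no-solution-52495396602 n (1≤n , N∣S-n) =
  ℕP.<⇒≢ 1≤n (sym (∣-all-powers⇒≡0 {5} (s≤s (s≤s z≤n)) five-adic-step))
  where
    Q N : ℕ
    Q = 52495396602
    N = Q * n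

    S≡n : S N N ≡ n mod N
    S≡n = mod-intro (ℤ∣.∣ᵤ⇒∣ N∣S-n)

    S[p]≢0 : ∀ {p} → p ℕ∣.∣ Q → 2 ≤ p → ¬ S N p ≡ 0 mod p
    S[p]≢0 p∣Q 2≤p S[p]≡0 = ℕP.<⇒≢ 1≤n (sym (∣-all-powers⇒≡0 2≤p
      (λ j → S≡n⇒p^[1+j]∣n-of-vanishing {j = j} p∣Q S[p]≡0 S≡n)))

    5⊥Q : Coprime 5 Q
    5⊥Q = from-yes (coprime? 5 Q)

    16∤N : ¬ 8 ℕ∣.∣ n → ¬ 16 ℕ∣.∣ N
    16∤N 8∤n 16∣N = 8∤n (coprime-divisor (from-yes (coprime? 8 26247698301))
      (ℕ∣.*-cancelˡ-∣ 2 (subst (16 ℕ∣.∣_) (ℕP.*-assoc 2 26247698301 n) 16∣N)))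

    10∤N : ¬ 5 ℕ∣.∣ n → ¬ 10 ℕ∣.∣ N
    10∤N 5∤n 10∣N = 5∤n (coprime-divisor 5⊥Q (ℕ∣.∣-trans (divides 2 refl) 10∣N))

    8∣n : 8 ℕ∣.∣ n
    8∣n = decidable-stable (8 ℕ∣.∣? n) λ 8∤n →
      S[p]≢0 (ℕ∣.m%n≡0⇒n∣m Q 17 refl) (s≤s (s≤s z≤n))
        (S≡0[mod-prime] {N = N} prime-17 (s≤s z≤n) (s≤s (s≤s (s≤s (s≤s z≤n))))
          (≢1-of-order (%≡⇒≡[mod] refl) 3^r≢1-mod-17-below-16 (16∤N 8∤n)))

    5∣n : 5 ℕ∣.∣ n
    5∣n = decidable-stable (5 ℕ∣.∣? n) λ 5∤n →
      S[p]≢0 (ℕ∣.m%n≡0⇒n∣m Q 11 refl) (s≤s (s≤s z≤n))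
        (S≡0[mod-prime] {N = N} prime-11 (s≤s z≤n) (s≤s (s≤s (s≤s z≤n)))
          (≢1-of-order (%≡⇒≡[mod] refl) 2^r≢1-mod-11-below-10 (10∤N 5∤n)))

    five-adic-step : ∀ j → 5 ^ j ℕ∣.∣ n → 5 ^ suc j ℕ∣.∣ n
    five-adic-step zero    _ = 5∣n
    five-adic-step (suc j) = S≡n⇒p^[2+j]∣n-of-fermat {j = j} prime-5
      (λ 5∣Q → case 5⊥Q (ℕ∣.∣-refl , 5∣Q) of λ ())
      {{ℕP.m*n≢0 Q n {{_}} {{ℕ.>-nonZero 1≤n}}}}
      (ℕ∣.∣n⇒∣m*n Q (ℕ∣.∣-trans (divides 2 refl) 8∣n)) S≡n

proposition4 : ((∃ λ n → InN 47058 n)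
                 × (∃ λ n → InN 2214502422 n)
                 × (∃ λ n → InN 8490421583559688410706771261086 n))
               × (∀ n → ¬ InN 52495396602 n)
proposition4 =
  ( (5 , witness-47058)
  , (5 , witness-2214502422)
  , (39607528021345872635 , witness-8490421583559688410706771261086))
  , no-solution-52495396602
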